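{- Let $G_1,\dots,G_k$ be the connected components of a graph $G$, and for $a\in\{1,\dots,k\}$ let $p_a$ be the strong separation dimension of $G_a$. Then $G$ has strong separation dimension at most $\max\{p_1,\dots,p_k,2\}$. Moreover, there is a strongly separating representation of $G$ with at most this many orderings such that in each ordering, $V(G_1)<V(G_2)<\dots<V(G_k)$ or $V(G_k)<V(G_{k-1})<\dots<V(G_1)$.
   Context: A representation of a graph $G$ is a non-empty set of linear orderings of $V(G)$. A representation $\{<_1,\dots,<_p\}$ of $G$ is strongly separating if (a) for all disjoint edges $vw,xy\in E(G)$, for some $i$ we have $v,w<_i x,y$ or $x,y<_i v,w$; and (b) for every edge $vw\in E(G)$ and vertex $x\in V(G)\setminus\{v,w\}$, there are $i,j\in\{1,\dots,p\}$ with $x<_i v,w$ and $v,w<_j x$. The strong separation dimension of $G$ is the minimum number of orderings in a strongly separating representation of $G$. For vertex sets $X,Y$, $X<Y$ in an ordering means every vertex of $X$ precedes every vertex of $Y$. -}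

module Defs where

open import Level using (0ℓ)
open import Data.Nat as ℕ using (ℕ; zero; suc; _≤_; _⊔_)
open import Data.Fin as Fin using (Fin)
open import Data.Product using (Σ; ∃; _×_; _,_; proj₁)
open import Data.Sum using (_⊎_)
open import Data.Empty using (⊥)
open import Relation.Binary.Core using (Rel)
open import Relation.Binary.Structures using (IsStrictTotalOrder)
open import Relation.Binary.PropositionalEquality using (_≡_; _≢_)
open import Relation.Binary.Construct.Closure.ReflexiveTransitive using (Star)
open import Function.Bundles using (_⇔_)

record Graph (V : Set) : Set₁ where
  field
    Adj    : Rel V 0ℓ
    sym    : ∀ {x y} → Adj x y → Adj y x
    irrefl : ∀ {x} → Adj x x → ⊥
open Graph public

record LinearOrder (V : Set) : Set₁ where
  field
    _<_     : Rel V 0ℓ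
    isLinear : IsStrictTotalOrder _≡_ _<_
open LinearOrder public

record Representation (V : Set) : Set₁ where
  field
    size     : ℕ
    nonEmpty : 1 ≤ size
    order    : Fin size → LinearOrder V
open Representation public

_<[_]_ : ∀ {V} {R : Representation V} → V → Fin (size R) → V → Set
_<[_]_ {R = R} x i y = _<_ (order R i) x y

module _ {V : Set} (G : Graph V) (R : Representation V) where
  private
    lt : Fin (size R) → V → V → Set
    lt i x y = _<_ (order R i) x y

  PairBefore : Fin (size R) → V → V → V → V → Set
  PairBefore i v w x y = lt i v x × lt i v y × lt i w x × lt i w y

  StronglySeparating : Set
  StronglySeparating =
    (∀ v w x y → Adj G v w → Adj G x y →
       v ≢ x → v ≢ y → w ≢ x → w ≢ y →
       ∃ λ i → PairBefore i v w x y ⊎ PairBefore i x y v w)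
    ×
    (∀ v w x → Adj G v w → x ≢ v → x ≢ w →
       (∃ λ i → lt i x v × lt i x w) × (∃ λ j → lt j v x × lt j w x))

IsSSDim : ∀ {V} → Graph V → ℕ → Set₁
IsSSDim {V} G p =
  (Σ (Representation V) λ R → StronglySeparating G R × size R ≡ p)
  × (∀ (R : Representation V) → StronglySeparating G R → p ≤ size R)

Connected : ∀ {V} → Graph V → V → V → Set
Connected G = Star (Adj G)

IsComponentLabelling : ∀ {V} → Graph V → (k : ℕ) → (V → Fin k) → Set
IsComponentLabelling G k c =
  (∀ a → ∃ λ x → c x ≡ a) × (∀ x y → (c x ≡ c y) ⇔ Connected G x y)

Component : ∀ {V} (G : Graph V) {k} (c : V → Fin k) (a : Fin k) →
            Graph (Σ V λ x → c x ≡ a)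
Component G c a = record
  { Adj    = λ x y → Adj G (proj₁ x) (proj₁ y)
  ; sym    = sym G
  ; irrefl = irrefl G
  }

maxOver : ∀ {k} → (Fin k → ℕ) → ℕ
maxOver {zero}  p = 0
maxOver {suc k} p = p Fin.zero ⊔ maxOver (λ a → p (Fin.suc a))

ComponentsInOrder : ∀ {V} {k} (c : V → Fin k) (R : Representation V) →
                    Fin (size R) → Set
ComponentsInOrder {V} c R i =
  (∀ x y → c x Fin.< c y → _<_ (order R i) x y)
  ⊎ (∀ x y → c y Fin.< c x → _<_ (order R i) x y)

module Submission where

-- Each component G_a has a strongly separating representation with p_a ≤ S
-- orderings; repeating its orderings cyclically pads it to exactly S
-- orderings without losing strong separation, since strong separation only
-- asks for witnesses among the orderings.  The i-th ordering of G is then the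
-- lexicographic sum of the i-th orderings of the components, with the
-- components arranged as V(G_1) < … < V(G_k) for i = 0 and in reverse for
-- i > 0.  Pairs of edges, or an edge and a vertex, in one component are
-- separated as they are in that component; objects in distinct components
-- are separated by the two opposite arrangements of the components.

open import Defs
open import Data.Nat using (ℕ; _≤_; _⊔_)
open import Data.Fin using (Fin)
open import Data.Product using (Σ; _×_)

open import Level using (0ℓ)
open import Data.Nat as ℕ using (_+_; _∸_; NonZero; z≤n; s≤s)
import Data.Nat.Properties as ℕ
open import Data.Nat.DivMod using (_mod_; m<n⇒m%n≡m)
open import Data.Fin as Fin using (toℕ; inject≤)
import Data.Fin.Properties as Fin
open import Data.Product using (∃; _,_; proj₁; proj₂)
open import Data.Sum using (inj₁; inj₂; _⊎_)
open import Data.Empty using (⊥-elim)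
open import Function using (_∘_; flip)
open import Function.Bundles using (Equivalence)
open import Relation.Nullary using (¬_; yes; no)
open import Relation.Binary.Core using (Rel)
open import Relation.Binary.Definitions using (Tri; tri<; tri≈; tri>)
open import Relation.Binary.Structures using (IsStrictTotalOrder)
import Relation.Binary.Construct.Flip.EqAndOrd as Flip
open import Relation.Binary.PropositionalEquality
  using (_≡_; _≢_; refl; cong; subst; subst₂; trans; isEquivalence)
  renaming (sym to ≡-sym)
open import Relation.Binary.Construct.Closure.ReflexiveTransitive using (ε; _◅_)
open import Axiom.UniquenessOfIdentityProofs using (module Decidable⇒UIP)

Fibre : {V K : Set} → (V → K) → K → Set
Fibre {V} c a = Σ V λ x → c x ≡ a

module LexicographicSum {V K : Set} (c : V → K)
    {_⊏_ : Rel K 0ℓ} (⊏-sto : IsStrictTotalOrder _≡_ _⊏_)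
    (inner : (a : K) → LinearOrder (Fibre c a)) where

  private
    module Labels = IsStrictTotalOrder ⊏-sto
    module Inner (a : K) = IsStrictTotalOrder (isLinear (inner a))

  data Within (x y : V) : Set where
    within : ∀ a (ex : c x ≡ a) (ey : c y ≡ a) →
             _<_ (inner a) (x , ex) (y , ey) → Within x y

  _⋖_ : Rel V 0ℓ
  x ⋖ y = c x ⊏ c y ⊎ Within x y

  -- Labels have decidable equality, so a point of a fibre is determined
  -- by its underlying element.
  fibre-point-≡ : ∀ {x y a} (ex : c x ≡ a) (ey : c y ≡ a) →
                  x ≡ y → _≡_ {A = Fibre c a} (x , ex) (y , ey)
  fibre-point-≡ ex ey refl = cong (_ ,_) (Decidable⇒UIP.≡-irrelevant Labels._≟_ ex ey)

  within-label : ∀ {x y} → Within x y → c x ≡ c y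
  within-label (within a ex ey _) = trans ex (≡-sym ey)

  ⋖-across : ∀ {x y} → c x ≢ c y → x ⋖ y → c x ⊏ c y
  ⋖-across _   (inj₁ d) = d
  ⋖-across c≢c (inj₂ w) = ⊥-elim (c≢c (within-label w))

  ⋖-in-fibre : ∀ {x y} b (ex : c x ≡ b) (ey : c y ≡ b) →
               x ⋖ y → _<_ (inner b) (x , ex) (y , ey)
  ⋖-in-fibre b ex ey (inj₁ d) = ⊥-elim (Labels.irrefl (trans ex (≡-sym ey)) d)
  ⋖-in-fibre b ex refl (inj₂ (within a ex′ refl r)) =
    subst (λ x̂ → _<_ (inner b) x̂ _) (fibre-point-≡ ex′ ex refl) r

  ⋖-irrefl : ∀ {x y} → x ≡ y → ¬ x ⋖ y
  ⋖-irrefl refl (inj₁ d) = Labels.irrefl refl d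
  ⋖-irrefl refl (inj₂ (within a ex ey r)) = Inner.irrefl a (fibre-point-≡ ex ey refl) r

  ⋖-trans : ∀ {x y z} → x ⋖ y → y ⋖ z → x ⋖ z
  ⋖-trans (inj₁ d) (inj₁ d′) = inj₁ (Labels.trans d d′)
  ⋖-trans {x} (inj₁ d) (inj₂ w) = inj₁ (subst (c x ⊏_) (within-label w) d)
  ⋖-trans {z = z} (inj₂ w) (inj₁ d) = inj₁ (subst (_⊏ c z) (≡-sym (within-label w)) d)
  ⋖-trans (inj₂ (within a ex refl r)) (inj₂ (within _ refl ez r′)) =
    inj₂ (within a ex ez (Inner.trans a r r′))

  ⋖-compare : ∀ x y → Tri (x ⋖ y) (x ≡ y) (y ⋖ x)
  ⋖-compare x y with Labels.compare (c x) (c y)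
  ... | tri< d c≢c _ = tri< (inj₁ d) (c≢c ∘ cong c) (Labels.asym d ∘ ⋖-across (c≢c ∘ ≡-sym))
  ... | tri> _ c≢c d = tri> (Labels.asym d ∘ ⋖-across c≢c) (c≢c ∘ cong c) (inj₁ d)
  ... | tri≈ _ e _ with Inner.compare (c y) (x , e) (y , refl)
  ...   | tri< r x̂≢ŷ r̸ =
          tri< (inj₂ (within _ e refl r)) (x̂≢ŷ ∘ fibre-point-≡ e refl)
               (r̸ ∘ ⋖-in-fibre _ refl e)
  ...   | tri≈ r̸ x̂≡ŷ r̸′ =
          tri≈ (r̸ ∘ ⋖-in-fibre _ e refl) (cong proj₁ x̂≡ŷ) (r̸′ ∘ ⋖-in-fibre _ refl e)
  ...   | tri> r̸ x̂≢ŷ r =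
          tri> (r̸ ∘ ⋖-in-fibre _ e refl) (x̂≢ŷ ∘ fibre-point-≡ e refl)
               (inj₂ (within _ refl e r))

  lexOrder : LinearOrder V
  lexOrder = record
    { _<_      = _⋖_
    ; isLinear = record
      { isStrictPartialOrder = record
        { isEquivalence = isEquivalence
        ; irrefl        = ⋖-irrefl
        ; trans         = ⋖-trans
        ; <-resp-≈      = (λ { refl r → r }) , (λ { refl r → r })
        }
      ; compare = ⋖-compare
      }
    }

_⊑_ : ∀ {V} → Representation V → Representation V → Set₁
R ⊑ R′ = ∀ j → ∃ λ i → order R′ i ≡ order R j

-- Strong separation only asks for witness orderings, so it survives
-- adding orderings.
stronglySeparating-mono : ∀ {V} (G : Graph V) {R R′ : Representation V} →
  R ⊑ R′ → StronglySeparating G R → StronglySeparating G R′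
stronglySeparating-mono {V} G {R} {R′} R⊑R′ (sep-edges , sep-vertex) =
  (λ v w x y vw xy v≢x v≢y w≢x w≢y →
     transfer (λ O → Before O v w x y ⊎ Before O x y v w)
              (sep-edges v w x y vw xy v≢x v≢y w≢x w≢y))
  , (λ v w x vw x≢v x≢w →
       let (first , last) = sep-vertex v w x vw x≢v x≢w
       in  transfer (λ O → _<_ O x v × _<_ O x w) first
         , transfer (λ O → _<_ O v x × _<_ O w x) last)
  where
  Before : LinearOrder V → V → V → V → V → Set
  Before O v w x y = _<_ O v x × _<_ O v y × _<_ O w x × _<_ O w y

  transfer : (P : LinearOrder V → Set) →
             ∃ (λ j → P (order R j)) → ∃ (λ i → P (order R′ i))
  transfer P (j , Pj) with R⊑R′ j
  ... | i , same = i , subst P (≡-sym same) Pj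

toℕ-mod : ∀ {s} .{{_ : NonZero s}} (j : Fin s) → toℕ j mod s ≡ j
toℕ-mod j = Fin.toℕ-injective (trans (Fin.toℕ-fromℕ< _) (m<n⇒m%n≡m (Fin.toℕ<n j)))

padTo : ∀ {V} (R : Representation V) (m : ℕ) → size R ≤ m → Representation V
padTo R m size≤m = record
  { size     = m
  ; nonEmpty = ℕ.≤-trans (nonEmpty R) size≤m
  ; order    = λ i → order R ((toℕ i mod size R) {{ℕ.>-nonZero (nonEmpty R)}})
  }

padTo-⊒ : ∀ {V} (R : Representation V) m (size≤m : size R ≤ m) → R ⊑ padTo R m size≤m
padTo-⊒ R m size≤m j = inject≤ j size≤m , cong (order R) wrap-inject
  where
  instance
    size≢0 : NonZero (size R)
    size≢0 = ℕ.>-nonZero (nonEmpty R)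
  wrap-inject : toℕ (inject≤ j size≤m) mod size R ≡ j
  wrap-inject = trans (cong (_mod size R) (Fin.toℕ-inject≤ j size≤m)) (toℕ-mod j)

padTo-stronglySeparating : ∀ {V} (G : Graph V) (R : Representation V) m
  (size≤m : size R ≤ m) → StronglySeparating G R → StronglySeparating G (padTo R m size≤m)
padTo-stronglySeparating G R m size≤m =
  stronglySeparating-mono G {R} {padTo R m size≤m} (padTo-⊒ R m size≤m)

module Combine {V : Set} (G : Graph V) {k : ℕ} (c : V → Fin k)
    (edge-inside : ∀ {v w} → Adj G v w → c v ≡ c w)
    (m : ℕ) (R : (a : Fin k) → Representation (Fibre c a))
    (R-sep : ∀ a → StronglySeparating (Component G c a) (R a))
    (R-fits : ∀ a → size (R a) ≤ 2 + m) where

  S : ℕ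
  S = 2 + m

  padded : (a : Fin k) → Representation (Fibre c a)
  padded a = padTo (R a) S (R-fits a)

  classOrder : Fin S → Rel (Fin k) 0ℓ
  classOrder Fin.zero    = Fin._<_
  classOrder (Fin.suc _) = flip Fin._<_

  classOrder-sto : ∀ i → IsStrictTotalOrder _≡_ (classOrder i)
  classOrder-sto Fin.zero    = Fin.<-isStrictTotalOrder
  classOrder-sto (Fin.suc _) = Flip.isStrictTotalOrder Fin.<-isStrictTotalOrder

  module Lex (i : Fin S) =
    LexicographicSum c (classOrder-sto i) (λ a → order (padded a) i)

  combined : Representation V
  combined = record { size = S ; nonEmpty = s≤s z≤n ; order = Lex.lexOrder }

  combined-ordered : ∀ i → ComponentsInOrder c combined i
  combined-ordered Fin.zero    = inj₁ λ _ _ → inj₁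
  combined-ordered (Fin.suc _) = inj₂ λ _ _ → inj₁

  lift : ∀ i {a} {x y : Fibre c a} → _<_ (order (padded a) i) x y →
         Lex._⋖_ i (proj₁ x) (proj₁ y)
  lift i {x = _ , ex} {_ , ey} r = inj₂ (Lex.within _ ex ey r)

  padded-sep : ∀ a → StronglySeparating (Component G c a) (padded a)
  padded-sep a = padTo-stronglySeparating (Component G c a) (R a) S (R-fits a) (R-sep a)

  liftPair : ∀ i {a} {v w x y : Fibre c a} →
             PairBefore (Component G c a) (padded a) i v w x y →
             PairBefore G combined i (proj₁ v) (proj₁ w) (proj₁ x) (proj₁ y)
  liftPair i (r₁ , r₂ , r₃ , r₄) = lift i r₁ , lift i r₂ , lift i r₃ , lift i r₄

  across : ∀ i {u u′ z z′} → c u ≡ c u′ → c z ≡ c z′ → classOrder i (c u) (c z) →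
           Lex._⋖_ i u′ z′
  across i cu≡ cz≡ d = inj₁ (subst₂ (classOrder i) cu≡ cz≡ d)

  pairAcross : ∀ i {v w x y} → c v ≡ c w → c x ≡ c y → classOrder i (c v) (c x) →
               PairBefore G combined i v w x y
  pairAcross i cv≡cw cx≡cy d =
    across i refl refl d , across i refl cx≡cy d , across i cv≡cw refl d , across i cv≡cw cx≡cy d

  separates-edges : ∀ v w x y → Adj G v w → Adj G x y →
    v ≢ x → v ≢ y → w ≢ x → w ≢ y →
    ∃ λ i → PairBefore G combined i v w x y ⊎ PairBefore G combined i x y v w
  separates-edges v w x y vw xy v≢x v≢y w≢x w≢y with c v Fin.≟ c x
  ... | yes cv≡cx
    with proj₁ (padded-sep (c v))
           (v , refl) (w , ≡-sym (edge-inside vw))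
           (x , ≡-sym cv≡cx) (y , ≡-sym (trans cv≡cx (edge-inside xy))) vw xy
           (v≢x ∘ cong proj₁) (v≢y ∘ cong proj₁) (w≢x ∘ cong proj₁) (w≢y ∘ cong proj₁)
  ...   | i , inj₁ before = i , inj₁ (liftPair i before)
  ...   | i , inj₂ after  = i , inj₂ (liftPair i after)
  separates-edges v w x y vw xy _ _ _ _ | no cv≢cx with Fin.<-cmp (c v) (c x)
  ... | tri< cv<cx _ _ = Fin.zero , inj₁ (pairAcross Fin.zero (edge-inside vw) (edge-inside xy) cv<cx)
  ... | tri≈ _ cv≡cx _ = ⊥-elim (cv≢cx cv≡cx)
  ... | tri> _ _ cx<cv = Fin.zero , inj₂ (pairAcross Fin.zero (edge-inside xy) (edge-inside vw) cx<cv)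

  vertexFirst : ∀ i {v w x} → c v ≡ c w → classOrder i (c x) (c v) →
                Lex._⋖_ i x v × Lex._⋖_ i x w
  vertexFirst i cv≡cw d = across i refl refl d , across i refl cv≡cw d

  vertexLast : ∀ i {v w x} → c v ≡ c w → classOrder i (c v) (c x) →
               Lex._⋖_ i v x × Lex._⋖_ i w x
  vertexLast i cv≡cw d = across i refl refl d , across i cv≡cw refl d

  separates-vertex : ∀ v w x → Adj G v w → x ≢ v → x ≢ w →
    (∃ λ i → Lex._⋖_ i x v × Lex._⋖_ i x w) × (∃ λ j → Lex._⋖_ j v x × Lex._⋖_ j w x)
  separates-vertex v w x vw x≢v x≢w with c x Fin.≟ c v
  ... | yes cx≡cv
    with proj₂ (padded-sep (c v)) (v , refl) (w , ≡-sym (edge-inside vw)) (x , cx≡cv) vw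
           (x≢v ∘ cong proj₁) (x≢w ∘ cong proj₁)
  ...   | (i , r₁ , r₂) , (j , r₃ , r₄) = (i , lift i r₁ , lift i r₂) , (j , lift j r₃ , lift j r₄)
  separates-vertex v w x vw _ _ | no cx≢cv with Fin.<-cmp (c x) (c v)
  ... | tri< cx<cv _ _ = (Fin.zero , vertexFirst Fin.zero (edge-inside vw) cx<cv)
                       , (Fin.suc Fin.zero , vertexLast (Fin.suc Fin.zero) (edge-inside vw) cx<cv)
  ... | tri≈ _ cx≡cv _ = ⊥-elim (cx≢cv cx≡cv)
  ... | tri> _ _ cv<cx = (Fin.suc Fin.zero , vertexFirst (Fin.suc Fin.zero) (edge-inside vw) cv<cx)
                       , (Fin.zero , vertexLast Fin.zero (edge-inside vw) cv<cx)

  combined-sep : StronglySeparating G combined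
  combined-sep = separates-edges , separates-vertex

maxOver-upper : ∀ {k} (p : Fin k → ℕ) a → p a ≤ maxOver p
maxOver-upper p Fin.zero    = ℕ.m≤m⊔n _ _
maxOver-upper p (Fin.suc a) = ℕ.≤-trans (maxOver-upper (p ∘ Fin.suc) a) (ℕ.m≤n⊔m _ _)

-- max(t, 2) written as 2 + m, the form in which Combine counts orderings
⊔2≡2+∸2 : ∀ t → t ⊔ 2 ≡ 2 + (t ∸ 2)
⊔2≡2+∸2 0                 = refl
⊔2≡2+∸2 1                 = refl
⊔2≡2+∸2 (ℕ.suc (ℕ.suc t)) = cong (2 +_) (ℕ.⊔-identityʳ t)

edge-inside-component : ∀ {V} {G : Graph V} {k} {c : V → Fin k} →
  IsComponentLabelling G k c → ∀ {v w} → Adj G v w → c v ≡ c w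
edge-inside-component (_ , same⇔connected) {v} {w} vw =
  Equivalence.from (same⇔connected v w) (vw ◅ ε)

lemma8 : (n : ℕ) (G : Graph (Fin n)) (k : ℕ) (c : Fin n → Fin k) →
         IsComponentLabelling G k c →
         (p : Fin k → ℕ) → (∀ a → IsSSDim (Component G c a) (p a)) →
         (∀ d → IsSSDim G d → d ≤ maxOver p ⊔ 2)
         × (Σ (Representation (Fin n)) λ R →
              StronglySeparating G R
              × size R ≤ maxOver p ⊔ 2
              × (∀ i → ComponentsInOrder c R i))
lemma8 n G k c labelling p dim =
    (λ d d-dim → ℕ.≤-trans (proj₂ d-dim combined combined-sep) size≤)
  , combined , combined-sep , size≤ , combined-ordered
  where
  t : ℕ
  t = maxOver p

  optimal : ∀ a → Σ (Representation (Fibre c a)) λ R →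
            StronglySeparating (Component G c a) R × size R ≡ p a
  optimal a = proj₁ (dim a)

  fits : ∀ a → size (proj₁ (optimal a)) ≤ 2 + (t ∸ 2)
  fits a = begin
    size (proj₁ (optimal a)) ≡⟨ proj₂ (proj₂ (optimal a)) ⟩
    p a                      ≤⟨ maxOver-upper p a ⟩
    t                        ≤⟨ ℕ.m≤m⊔n t 2 ⟩
    t ⊔ 2                    ≡⟨ ⊔2≡2+∸2 t ⟩
    2 + (t ∸ 2)              ∎
    where open ℕ.≤-Reasoning

  open Combine G c (edge-inside-component {G = G} {c = c} labelling) (t ∸ 2)
         (λ a → proj₁ (optimal a)) (λ a → proj₁ (proj₂ (optimal a))) fits

  size≤ : size combined ≤ t ⊔ 2
  size≤ = ℕ.≤-reflexive (≡-sym (⊔2≡2+∸2 t))
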